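{- Valuated flag gammoids are closed under translation: if $\boldsymbol\mu=(\mu_1,\dots,\mu_s)$ is a valuated flag gammoid on $[n]$ and $x\in\mathbb R^n$, then $\boldsymbol\mu+x=(\mu_1+x,\dots,\mu_s+x)$, where $(\mu_k+x)(B)=\mu_k(B)+\sum_{i\in B}x_i$, is a valuated flag gammoid.
   Context: A valuated flag gammoid is a tuple $(\mu_1,\dots,\mu_s)$ obtained as follows: $\Gamma=(V,E)$ is a directed graph with $[n]\subseteq V$, $w:E\to\mathbb R$ edge weights with no directed cycle of negative total weight, and $S_1\subset\dots\subset S_s\subseteq V$ with $|S_k|=d_k$, $d_1<\dots<d_s$, such that for every $k$ some $d_k$-subset of $[n]$ has a linking onto $S_k$; then $\mu_k(I)$, for $I\in\binom{[n]}{d_k}$, is the minimum weight of a linking from $I$ onto $S_k$ ($\infty$ if none). A linking from $I$ onto $J$ ($|I|=|J|$) is a family of $|I|$ pairwise vertex-disjoint directed paths each from a vertex of $I$ to a vertex of $J$; its weight is the total weight of its edges. -}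

module Defs where

open import Level using (0ℓ)
open import Data.Nat as ℕ using (ℕ; zero; suc)
open import Data.Fin using (Fin; zero; suc)
open import Data.Fin.Subset using (Subset; _∈_; _⊆_; ∣_∣)
open import Data.Bool using (true; false)
open import Data.Vec using ([]; _∷_)
open import Data.List as List using (List; []; _∷_; length)
open import Data.List.Membership.Propositional as LM using ()
open import Data.List.Relation.Unary.All using (All)
open import Data.List.Relation.Unary.AllPairs using (AllPairs)
open import Data.List.Relation.Unary.Unique.Propositional using (Unique)
open import Data.Maybe using (Maybe; just; nothing)
open import Data.Product using (Σ; ∃; ∃-syntax; _×_; _,_)
open import Data.Empty using (⊥)
open import Relation.Nullary using (¬_)
open import Relation.Binary.PropositionalEquality using (_≡_)
open import Algebra.Structures using (IsCommutativeRing)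
open import Relation.Binary.Structures using (IsTotalOrder)
open import Function.Definitions using (Injective)

-- The real numbers, axiomatised as a Dedekind-complete ordered field
-- (the standard library has no reals; any model of this record is,
-- classically, isomorphic to ℝ).

record RealNumbers : Set₁ where
  infixl 6 _+_
  infixl 7 _*_
  infix 4 _≤_
  field
    Carrier : Set
    _+_ _*_ : Carrier → Carrier → Carrier
    -_      : Carrier → Carrier
    0# 1#   : Carrier
    _≤_     : Carrier → Carrier → Set
    isCommutativeRing : IsCommutativeRing _≡_ _+_ _*_ -_ 0# 1#
    isTotalOrder      : IsTotalOrder _≡_ _≤_
    0≢1     : ¬ (0# ≡ 1#)
    inverse : ∀ x → ¬ (x ≡ 0#) → ∃[ y ] (x * y ≡ 1#)
    +-mono-≤ : ∀ {x y} z → x ≤ y → x + z ≤ y + z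
    *-nonneg : ∀ {x y} → 0# ≤ x → 0# ≤ y → 0# ≤ x * y
    complete : (P : Carrier → Set) → (∃[ x ] P x) →
               (∃[ b ] (∀ x → P x → x ≤ b)) →
               ∃[ s ] ((∀ x → P x → x ≤ s) ×
                       (∀ b → (∀ x → P x → x ≤ b) → s ≤ b))

module Gammoid (ℝ : RealNumbers) where
  open RealNumbers ℝ

  -- ℝ ∪ {∞}, with nothing = ∞
  ℝ∞ : Set
  ℝ∞ = Maybe Carrier

  _+∞_ : ℝ∞ → Carrier → ℝ∞
  nothing +∞ a = nothing
  just b  +∞ a = just (b + a)

  sumOver : ∀ {n} → Subset n → (Fin n → Carrier) → Carrier
  sumOver [] x = 0#
  sumOver (true  ∷ B) x = x zero + sumOver B (λ i → x (suc i))
  sumOver (false ∷ B) x = sumOver B (λ i → x (suc i))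

  -- A weighted directed graph on the vertex set V = Fin m:
  -- w u v = just r  iff  (u,v) is an edge, of weight r.
  WDigraph : ℕ → Set
  WDigraph m = Fin m → Fin m → Maybe Carrier

  module _ {m : ℕ} (w : WDigraph m) where

    data Walk : Fin m → Fin m → Set where
      []   : ∀ {v} → Walk v v
      step : ∀ {u v t} (r : Carrier) → w u v ≡ just r → Walk v t → Walk u t

    vertices : ∀ {u t} → Walk u t → List (Fin m)
    vertices {u} [] = u ∷ []
    vertices {u} (step r e p) = u ∷ vertices p

    walkWeight : ∀ {u t} → Walk u t → Carrier
    walkWeight [] = 0#
    walkWeight (step r e p) = r + walkWeight p

    record Path : Set where
      constructor path
      field
        src tgt : Fin m
        walk    : Walk src tgt
        simple  : Unique (vertices walk)

    open Path public

    pathWeight : Path → Carrier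
    pathWeight p = walkWeight (walk p)

    -- no directed cycle of negative total weight; a directed cycle is an
    -- edge u → v followed by a directed path from v back to u
    NoNegativeCycle : Set
    NoNegativeCycle = ∀ u v r → w u v ≡ just r →
      (p : Walk v u) → Unique (vertices p) → 0# ≤ r + walkWeight p

    VertexDisjoint : Path → Path → Set
    VertexDisjoint p q = ∀ v → v LM.∈ vertices (walk p) → v LM.∈ vertices (walk q) → ⊥

    record Linking (A : Fin m → Set) (B : Subset m) (size : ℕ) : Set where
      field
        paths    : List Path
        count    : length paths ≡ size
        disjoint : AllPairs VertexDisjoint paths
        ends     : All (λ p → A (src p) × tgt p ∈ B) paths

    open Linking public

    linkingWeight : ∀ {A B size} → Linking A B size → Carrier
    linkingWeight L = List.foldr (λ p r → pathWeight p + r) 0# (paths L)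

    IsMinLinkingWeight : (A : Fin m → Set) (B : Subset m) (size : ℕ) → ℝ∞ → Set
    IsMinLinkingWeight A B size nothing = Linking A B size → ⊥
    IsMinLinkingWeight A B size (just a) =
      (Σ (Linking A B size) λ L → linkingWeight L ≡ a) ×
      (∀ (L : Linking A B size) → a ≤ linkingWeight L)

  imageOf : ∀ {n m} → (Fin n → Fin m) → Subset n → Fin m → Set
  imageOf ι I v = ∃[ i ] (i ∈ I × ι i ≡ v)

  FlagTuple : (n s : ℕ) → (Fin s → ℕ) → Set
  FlagTuple n s d = (k : Fin s) (I : Subset n) → ∣ I ∣ ≡ d k → ℝ∞

  IsValuatedFlagGammoid : (n s : ℕ) (d : Fin s → ℕ) → FlagTuple n s d → Set
  IsValuatedFlagGammoid n s d μ =
    (∀ (k l : Fin s) → k Data.Fin.< l → d k ℕ.< d l) ×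
    ∃[ m ] Σ (Fin n → Fin m) λ ι → Injective _≡_ _≡_ ι ×
    Σ (WDigraph m) λ w → NoNegativeCycle w ×
    Σ (Fin s → Subset m) λ S →
      (∀ k → ∣ S k ∣ ≡ d k) ×
      (∀ (k l : Fin s) → k Data.Fin.< l → S k ⊆ S l) ×
      (∀ k → Σ (Subset n) λ I → ∣ I ∣ ≡ d k ×
                 Linking w (imageOf ι I) (S k) (d k)) ×
      (∀ k (I : Subset n) (p : ∣ I ∣ ≡ d k) →
         IsMinLinkingWeight w (imageOf ι I) (S k) (d k) (μ k I p))

  translate : ∀ {n s d} → FlagTuple n s d → (Fin n → Carrier) → FlagTuple n s d
  translate μ x k B p = μ k B p +∞ sumOver B x

-- Given a presentation (Γ, w, S_1 ⊂ … ⊂ S_s) of μ, add for every i ∈ [n] a new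
-- vertex `new i` with a single edge new i → i of weight x_i, and let the ground set
-- be the new vertices. No edge enters a new vertex, so no new cycle arises, and
-- the linkings from new(I) onto S_k are exactly the linkings from I onto S_k with
-- one edge prepended to each path. Each i ∈ I is the source of exactly one path, so
-- every linking weight, and hence every minimum, grows by Σ_{i ∈ I} x_i.
module Submission where

open import Defs
open import Function using (_∘_; flip)
open import Data.Nat as ℕ using (ℕ; zero; suc)
open import Data.Nat.Properties using (suc-injective; +-identityʳ)
open import Data.Fin using (Fin; zero; suc; _↑ˡ_; _↑ʳ_; splitAt)
open import Data.Fin.Properties
  using (_≟_; splitAt-↑ˡ; splitAt-↑ʳ; join-splitAt; ↑ˡ-injective; ↑ʳ-injective)
open import Data.Fin.Subset using (Subset; _∈_; _⊆_; ∣_∣; inside; outside)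
  renaming (⊥ to ∅)
open import Data.Fin.Subset.Properties using (∉⊥; ∣⊥∣≡0; drop-∷-⊆)
open import Data.Vec using ([]; _∷_; _++_; _[_]≔_; here; there)
open import Data.List as List using (List; []; _∷_; length)
open import Data.List.Relation.Unary.All as All using (All; []; _∷_)
open import Data.List.Relation.Unary.All.Properties using () renaming (map⁺ to All-map⁺)
open import Data.List.Relation.Unary.Any using (here; there)
open import Data.List.Relation.Unary.AllPairs using (AllPairs; []; _∷_)
open import Data.List.Relation.Unary.Unique.Propositional using (Unique)
import Data.List.Relation.Unary.Unique.Propositional.Properties as Unique
open import Data.List.Relation.Binary.Pointwise using (Pointwise; []; _∷_)
open import Data.List.Relation.Binary.Pointwise.Properties using (symmetric; Pointwise-length)
import Data.List.Membership.Propositional as List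
open import Data.List.Membership.Propositional.Properties using (∈-map⁻; ∈-map⁺)
open import Data.Maybe using (Maybe; just; nothing)
open import Data.Sum using (_⊎_; inj₁; inj₂)
open import Data.Product using (Σ; ∃-syntax; _×_; _,_; proj₁; proj₂)
open import Data.Empty using (⊥; ⊥-elim)
open import Relation.Nullary using (¬_; yes; no; contradiction)
open import Relation.Binary.PropositionalEquality
open import Algebra.Bundles using (CommutativeSemigroup)
open import Algebra.Structures using (IsCommutativeRing)
import Algebra.Properties.CommutativeSemigroup as CommutativeSemigroupProperties

module _ {a b r} {A : Set a} {B : Set b} {R : A → B → Set r} where

  All⇒Pointwise : ∀ {p} {P : A → Set p} → (∀ {x} → P x → ∃[ y ] R x y) →
                  ∀ {xs} → All P xs → ∃[ ys ] Pointwise R xs ys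
  All⇒Pointwise f [] = [] , []
  All⇒Pointwise f (px ∷ pxs) with f px | All⇒Pointwise f pxs
  ... | y , rxy | ys , rs = y ∷ ys , rxy ∷ rs

  All-transport : ∀ {p q} {P : A → Set p} {Q : B → Set q} →
                  (∀ {x y} → R x y → P x → Q y) →
                  ∀ {xs ys} → Pointwise R xs ys → All P xs → All Q ys
  All-transport f [] [] = []
  All-transport f (rxy ∷ rs) (px ∷ pxs) = f rxy px ∷ All-transport f rs pxs

  AllPairs-transport : ∀ {p q} {P : A → A → Set p} {Q : B → B → Set q} →
                       (∀ {x x′ y y′} → R x y → R x′ y′ → P x x′ → Q y y′) →
                       ∀ {xs ys} → Pointwise R xs ys → AllPairs P xs → AllPairs Q ys
  AllPairs-transport f [] [] = []
  AllPairs-transport f (rxy ∷ rs) (pxs ∷ ps) =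
    All-transport (f rxy) rs pxs ∷ AllPairs-transport f rs ps

∈-remove : ∀ {k} (I : Subset k) {i j} → i ≢ j → j ∈ I → j ∈ I [ i ]≔ outside
∈-remove (_ ∷ I) {zero}  {zero}  i≢j _         = ⊥-elim (i≢j refl)
∈-remove (_ ∷ I) {zero}  {suc j} i≢j (there p) = there p
∈-remove (_ ∷ I) {suc i} {zero}  i≢j here      = here
∈-remove (_ ∷ I) {suc i} {suc j} i≢j (there p) = there (∈-remove I (i≢j ∘ cong suc) p)

∣remove∣ : ∀ {k} (I : Subset k) {i} → i ∈ I → suc ∣ I [ i ]≔ outside ∣ ≡ ∣ I ∣
∣remove∣ (inside  ∷ I) here      = refl
∣remove∣ (outside ∷ I) (there p) = ∣remove∣ I p
∣remove∣ (inside  ∷ I) (there p) = cong suc (∣remove∣ I p)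

∈-++⁺ˡ : ∀ {k l} {S : Subset k} (U : Subset l) {a} → a ∈ S → a ↑ˡ l ∈ S ++ U
∈-++⁺ˡ U here      = here
∈-++⁺ˡ U (there p) = there (∈-++⁺ˡ U p)

∈-++⁻ˡ : ∀ {k l} (S : Subset k) {U : Subset l} {a} → a ↑ˡ l ∈ S ++ U → a ∈ S
∈-++⁻ˡ (_ ∷ S) {a = zero}  here      = here
∈-++⁻ˡ (_ ∷ S) {a = suc a} (there p) = there (∈-++⁻ˡ S p)

∈-++⁻ʳ : ∀ {k l} (S : Subset k) {U : Subset l} {i} → k ↑ʳ i ∈ S ++ U → i ∈ U
∈-++⁻ʳ []      p         = p
∈-++⁻ʳ (_ ∷ S) (there p) = ∈-++⁻ʳ S p

∣++∣ : ∀ {k l} (S : Subset k) (U : Subset l) → ∣ S ++ U ∣ ≡ ∣ S ∣ ℕ.+ ∣ U ∣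
∣++∣ []            U = refl
∣++∣ (inside  ∷ S) U = cong suc (∣++∣ S U)
∣++∣ (outside ∷ S) U = ∣++∣ S U

++⁺-⊆ : ∀ {k l} {S T : Subset k} (U : Subset l) → S ⊆ T → S ++ U ⊆ T ++ U
++⁺-⊆ {S = []}    {[]}    U S⊆T p = p
++⁺-⊆ {S = _ ∷ S} {_ ∷ T} U S⊆T here with S⊆T here
... | here = here
++⁺-⊆ {S = _ ∷ S} {_ ∷ T} U S⊆T (there p) = there (++⁺-⊆ U (drop-∷-⊆ S⊆T) p)

∣++∅∣ : ∀ {k l} (S : Subset k) → ∣ S ++ ∅ {l} ∣ ≡ ∣ S ∣
∣++∅∣ {l = l} S = trans (∣++∣ S ∅) (trans (cong (∣ S ∣ ℕ.+_) (∣⊥∣≡0 l)) (+-identityʳ ∣ S ∣))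

module Sums (ℝ : RealNumbers) where
  open RealNumbers ℝ
  open Gammoid ℝ using (sumOver)

  +-commutativeSemigroup : CommutativeSemigroup _ _
  +-commutativeSemigroup = record
    { Carrier = Carrier ; _≈_ = _≡_ ; _∙_ = _+_
    ; isCommutativeSemigroup = IsCommutativeRing.+-isCommutativeSemigroup isCommutativeRing }

  open CommutativeSemigroupProperties +-commutativeSemigroup public
    using (x∙yz≈y∙xz; interchange)

  sumList : ∀ {k} → (Fin k → Carrier) → List (Fin k) → Carrier
  sumList x = List.foldr (λ i r → x i + r) 0#

  sumOver-∣∣≡0 : ∀ {k} (I : Subset k) x → ∣ I ∣ ≡ 0 → sumOver I x ≡ 0#
  sumOver-∣∣≡0 []            x _ = refl
  sumOver-∣∣≡0 (outside ∷ I) x e = sumOver-∣∣≡0 I (x ∘ suc) e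

  sumOver-remove : ∀ {k} (I : Subset k) x {i} → i ∈ I →
                   sumOver I x ≡ x i + sumOver (I [ i ]≔ outside) x
  sumOver-remove (inside  ∷ I) x here      = refl
  sumOver-remove (outside ∷ I) x (there p) = sumOver-remove I (x ∘ suc) p
  sumOver-remove (inside  ∷ I) x {suc i} (there p) = begin
    x zero + sumOver I (x ∘ suc)
      ≡⟨ cong (x zero +_) (sumOver-remove I (x ∘ suc) p) ⟩
    x zero + (x (suc i) + sumOver (I [ i ]≔ outside) (x ∘ suc))
      ≡⟨ x∙yz≈y∙xz (x zero) (x (suc i)) _ ⟩
    x (suc i) + (x zero + sumOver (I [ i ]≔ outside) (x ∘ suc)) ∎
    where open ≡-Reasoning

  sumList≡sumOver : ∀ {k} x (I : Subset k) {l} → Unique l → All (_∈ I) l →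
                    length l ≡ ∣ I ∣ → sumList x l ≡ sumOver I x
  sumList≡sumOver x I {[]}    _          _          e = sym (sumOver-∣∣≡0 I x (sym e))
  sumList≡sumOver {k} x I {i ∷ l} (i∉l ∷ ul) (i∈I ∷ l⊆I) e = begin
    x i + sumList x l                      ≡⟨ cong (x i +_) (sumList≡sumOver x I′ ul l⊆I′ |l|≡|I′|) ⟩
    x i + sumOver I′ x                     ≡⟨ sym (sumOver-remove I x i∈I) ⟩
    sumOver I x                            ∎
    where
    open ≡-Reasoning
    I′ : Subset k
    I′ = I [ i ]≔ outside
    l⊆I′ : All (_∈ I′) l
    l⊆I′ = All.zipWith (λ (i≢j , j∈I) → ∈-remove I i≢j j∈I) (i∉l , l⊆I)
    |l|≡|I′| : length l ≡ ∣ I′ ∣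
    |l|≡|I′| = suc-injective (trans e (sym (∣remove∣ I i∈I)))

module Extension (ℝ : RealNumbers) {n m : ℕ} (ι : Fin n → Fin m)
                 (w : Gammoid.WDigraph ℝ m) (x : Fin n → RealNumbers.Carrier ℝ) where
  open RealNumbers ℝ
  open Gammoid ℝ
  open Sums ℝ

  old : Fin m → Fin (m ℕ.+ n)
  old a = a ↑ˡ n

  new : Fin n → Fin (m ℕ.+ n)
  new i = m ↑ʳ i

  data VertexView : Fin (m ℕ.+ n) → Set where
    is-old : ∀ a → VertexView (old a)
    is-new : ∀ i → VertexView (new i)

  view : ∀ v → VertexView v
  view v with splitAt m v | join-splitAt m n v
  ... | inj₁ a | refl = is-old a
  ... | inj₂ i | refl = is-new i

  old-injective : ∀ {a b} → old a ≡ old b → a ≡ b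
  old-injective = ↑ˡ-injective n _ _

  new≢old : ∀ i a → new i ≢ old a
  new≢old i a eq
    with trans (sym (splitAt-↑ʳ m n i)) (trans (cong (splitAt m) eq) (splitAt-↑ˡ m a n))
  ... | ()

  w⁺ : WDigraph (m ℕ.+ n)
  w⁺ u v = edge (splitAt m u) (splitAt m v)
    where
    edge : Fin m ⊎ Fin n → Fin m ⊎ Fin n → Maybe Carrier
    edge (inj₁ a) (inj₁ b) = w a b
    edge (inj₂ i) (inj₁ b) with ι i ≟ b
    ... | yes _ = just (x i)
    ... | no _  = nothing
    edge _        (inj₂ _) = nothing

  w⁺-old-old : ∀ a b → w⁺ (old a) (old b) ≡ w a b
  w⁺-old-old a b rewrite splitAt-↑ˡ m a n | splitAt-↑ˡ m b n = refl

  w⁺-new-ι : ∀ i → w⁺ (new i) (old (ι i)) ≡ just (x i)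
  w⁺-new-ι i rewrite splitAt-↑ʳ m n i | splitAt-↑ˡ m (ι i) n with ι i ≟ ι i
  ... | yes _     = refl
  ... | no ιi≢ιi  = ⊥-elim (ιi≢ιi refl)

  w⁺-into-new : ∀ u i → w⁺ u (new i) ≡ nothing
  w⁺-into-new u i rewrite splitAt-↑ʳ m n i with splitAt m u
  ... | inj₁ _ = refl
  ... | inj₂ _ = refl

  no-edge-into-new : ∀ {u i r} → ¬ (w⁺ u (new i) ≡ just r)
  no-edge-into-new {u} {i} e with trans (sym e) (w⁺-into-new u i)
  ... | ()

  w⁺-from-new : ∀ {i v r} → w⁺ (new i) v ≡ just r → v ≡ old (ι i) × r ≡ x i
  w⁺-from-new {i} {v} e with view v
  ... | is-new j = contradiction e no-edge-into-new
  ... | is-old b rewrite splitAt-↑ʳ m n i | splitAt-↑ˡ m b n with ι i ≟ b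
  w⁺-from-new refl | is-old b | yes refl = refl , refl
  w⁺-from-new ()   | is-old b | no _

  w⁺-from-old : ∀ {a v r} → w⁺ (old a) v ≡ just r → ∃[ b ] (v ≡ old b × w a b ≡ just r)
  w⁺-from-old {a} {v} e with view v
  ... | is-new j = contradiction e no-edge-into-new
  ... | is-old b = b , refl , trans (sym (w⁺-old-old a b)) e

  IsLift : ∀ {a b u t} → Walk w a b → Walk w⁺ u t → Set
  IsLift p q = List.map old (vertices w p) ≡ vertices w⁺ q × walkWeight w p ≡ walkWeight w⁺ q

  liftWalk : ∀ {a b} → Walk w a b → Walk w⁺ (old a) (old b)
  liftWalk []           = []
  liftWalk (step r e p) = step r (trans (w⁺-old-old _ _) e) (liftWalk p)

  liftWalk-isLift : ∀ {a b} (p : Walk w a b) → IsLift p (liftWalk p)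
  liftWalk-isLift []           = refl , refl
  liftWalk-isLift (step r e p) with liftWalk-isLift p
  ... | vs , ws = cong (_ ∷_) vs , cong (r +_) ws

  lowerWalk : ∀ {a t} (q : Walk w⁺ (old a) t) →
              ∃[ b ] (t ≡ old b × Σ (Walk w a b) λ p → IsLift p q)
  lowerWalk {a} []           = a , refl , [] , refl , refl
  lowerWalk     (step r e q) with w⁺-from-old e
  ... | _ , refl , e′ with lowerWalk q
  ... | b , t≡b , p , vs , ws = b , t≡b , step r e′ p , cong (_ ∷_) vs , cong (r +_) ws

  unique-lift : ∀ {a b u t} {p : Walk w a b} {q : Walk w⁺ u t} → IsLift p q →
                Unique (vertices w p) → Unique (vertices w⁺ q)
  unique-lift (vs , _) u = subst Unique vs (Unique.map⁺ old-injective u)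

  unique-lower : ∀ {a b u t} {p : Walk w a b} {q : Walk w⁺ u t} → IsLift p q →
                 Unique (vertices w⁺ q) → Unique (vertices w p)
  unique-lower (vs , _) u = Unique.map⁻ (subst Unique (sym vs) u)

  walk-into-new : ∀ {v i} → Walk w⁺ v (new i) → v ≡ new i
  walk-into-new []           = refl
  walk-into-new (step r e q) with walk-into-new q
  ... | refl = contradiction e no-edge-into-new

  noNegativeCycle⁺ : NoNegativeCycle w → NoNegativeCycle w⁺
  noNegativeCycle⁺ noNeg u v r e q uq with view u
  ... | is-new i with walk-into-new q
  ...   | refl = contradiction e no-edge-into-new
  noNegativeCycle⁺ noNeg u v r e q uq | is-old a with w⁺-from-old e
  ... | b , refl , e′ with lowerWalk q
  ...   | c , c≡a , p , lift@(_ , ws) with old-injective c≡a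
  ...     | refl = subst (λ z → 0# ≤ r + z) ws (noNeg a b r e′ p (unique-lower lift uq))

  record Extends (i : Fin n) (p : Path w) (p′ : Path w⁺) : Set where
    field
      src≡ι     : ι i ≡ src p
      src≡new   : src p′ ≡ new i
      vertices≡ : vertices w⁺ (walk p′) ≡ new i ∷ List.map old (vertices w (walk p))
      weight≡   : pathWeight w⁺ p′ ≡ x i + pathWeight w p
      tgt≡      : tgt p′ ≡ old (tgt p)

  open Extends

  extendPath : ∀ i (p : Path w) → ι i ≡ src p → Σ (Path w⁺) (Extends i p)
  extendPath i (path _ b p u) refl with liftWalk-isLift p
  ... | lift@(vs , ws) =
    path (new i) (old b) (step (x i) (w⁺-new-ι i) (liftWalk p)) (new-fresh ∷ unique-lift lift u) ,
    record { src≡ι = refl ; src≡new = refl ; vertices≡ = cong (new i ∷_) (sym vs)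
           ; weight≡ = cong (x i +_) (sym ws) ; tgt≡ = refl }
    where
    new-fresh : All (new i ≢_) (vertices w⁺ (liftWalk p))
    new-fresh = subst (All (new i ≢_)) vs (All-map⁺ (All.tabulate λ {a} _ → new≢old i a))

  restrictPath : ∀ {i} (p′ : Path w⁺) → src p′ ≡ new i → tgt p′ ≢ new i →
                 Σ (Path w) λ p → Extends i p p′
  restrictPath     (path _ _ [] _)               refl t≢i = ⊥-elim (t≢i refl)
  restrictPath {i} (path _ _ (step r e q) (_ ∷ u)) refl _ with w⁺-from-new e
  ... | refl , refl with lowerWalk q
  ...   | b , refl , p , lift@(vs , ws) =
    path (ι i) b p (unique-lower lift u) ,
    record { src≡ι = refl ; src≡new = refl ; vertices≡ = cong (new i ∷_) (sym vs)
           ; weight≡ = cong (x i +_) (sym ws) ; tgt≡ = refl }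

  src∈vertices : ∀ {k} {v : WDigraph k} (p : Path v) → src p List.∈ vertices v (walk p)
  src∈vertices (path _ _ []           _) = here refl
  src∈vertices (path _ _ (step _ _ _) _) = here refl

  module _ {i j p q p′ q′} (ep : Extends i p p′) (eq : Extends j q q′) where

    vertexDisjoint⁺ : VertexDisjoint w p q → VertexDisjoint w⁺ p′ q′
    vertexDisjoint⁺ d v v∈p′ v∈q′ =
      split (subst (v List.∈_) (vertices≡ ep) v∈p′) (subst (v List.∈_) (vertices≡ eq) v∈q′)
      where
      split : v List.∈ new i ∷ List.map old (vertices w (walk p)) →
              v List.∈ new j ∷ List.map old (vertices w (walk q)) → ⊥
      split (here refl) (here i≡j) with ↑ʳ-injective m i j i≡j
      ... | refl = d (src p) (src∈vertices p)
                     (subst (List._∈ vertices w (walk q)) (trans (sym (src≡ι eq)) (src≡ι ep))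
                            (src∈vertices q))
      split (here refl) (there v∈q) with ∈-map⁻ old v∈q
      ... | a , _ , e = new≢old i a e
      split (there v∈p) (here refl) with ∈-map⁻ old v∈p
      ... | a , _ , e = new≢old j a e
      split (there v∈p) (there v∈q) with ∈-map⁻ old v∈p | ∈-map⁻ old v∈q
      ... | a , a∈p , refl | b , b∈q , e with old-injective e
      ... | refl = d a a∈p b∈q

    vertexDisjoint⁻ : VertexDisjoint w⁺ p′ q′ → VertexDisjoint w p q
    vertexDisjoint⁻ d v v∈p v∈q =
      d (old v) (subst (old v List.∈_) (sym (vertices≡ ep)) (there (∈-map⁺ old v∈p)))
                (subst (old v List.∈_) (sym (vertices≡ eq)) (there (∈-map⁺ old v∈q)))

    distinct-sources : VertexDisjoint w⁺ p′ q′ → i ≢ j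
    distinct-sources d refl =
      d (new i) (subst (new i List.∈_) (sym (vertices≡ ep)) (here refl))
                (subst (new i List.∈_) (sym (vertices≡ eq)) (here refl))

  pathsWeight : ∀ {k} (v : WDigraph k) → List (Path v) → Carrier
  pathsWeight v = List.foldr (λ p r → pathWeight v p + r) 0#

  module _ (I : Subset n) (S : Subset m) where

    S⁺ : Subset (m ℕ.+ n)
    S⁺ = S ++ ∅

    Corresponds : Path w → Path w⁺ → Set
    Corresponds p p′ = ∃[ i ] (i ∈ I × Extends i p p′)

    EndsIn : ∀ {k} {v : WDigraph k} → (Fin k → Set) → Subset k → Path v → Set
    EndsIn A B p = A (src p) × tgt p ∈ B

    extend : ∀ {p} → EndsIn (imageOf ι I) S p → ∃[ p′ ] Corresponds p p′
    extend {p} ((i , i∈I , ιi≡src) , _) =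
      let p′ , ext = extendPath i p ιi≡src in p′ , i , i∈I , ext

    restrict : ∀ {p′} → EndsIn (imageOf new I) S⁺ p′ → ∃[ p ] Corresponds p p′
    restrict {p′} ((i , i∈I , newi≡src) , t∈S⁺) =
      let p , ext = restrictPath p′ (sym newi≡src) t≢new in p , i , i∈I , ext
      where
      t≢new : tgt p′ ≢ new i
      t≢new t≡new = ∉⊥ (∈-++⁻ʳ S (subst (_∈ S⁺) t≡new t∈S⁺))

    endsIn⁺ : ∀ {p p′} → Corresponds p p′ →
              EndsIn (imageOf ι I) S p → EndsIn (imageOf new I) S⁺ p′
    endsIn⁺ (i , i∈I , ext) (_ , t∈S) =
      (i , i∈I , sym (src≡new ext)) , subst (_∈ S⁺) (sym (tgt≡ ext)) (∈-++⁺ˡ ∅ t∈S)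

    endsIn⁻ : ∀ {p p′} → Corresponds p p′ →
              EndsIn (imageOf new I) S⁺ p′ → EndsIn (imageOf ι I) S p
    endsIn⁻ (i , i∈I , ext) (_ , t∈S⁺) =
      (i , i∈I , src≡ι ext) , ∈-++⁻ˡ S (subst (_∈ S⁺) (tgt≡ ext) t∈S⁺)

    sources : ∀ {ps ps′} → Pointwise Corresponds ps ps′ → List (Fin n)
    sources []              = []
    sources ((i , _) ∷ pw) = i ∷ sources pw

    sources⊆I : ∀ {ps ps′} (pw : Pointwise Corresponds ps ps′) → All (_∈ I) (sources pw)
    sources⊆I []                  = []
    sources⊆I ((_ , i∈I , _) ∷ pw) = i∈I ∷ sources⊆I pw

    length-sources : ∀ {ps ps′} (pw : Pointwise Corresponds ps ps′) →
                     length (sources pw) ≡ length ps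
    length-sources []       = refl
    length-sources (_ ∷ pw) = cong suc (length-sources pw)

    unique-sources : ∀ {ps ps′} (pw : Pointwise Corresponds ps ps′) →
                     AllPairs (VertexDisjoint w⁺) ps′ → Unique (sources pw)
    unique-sources []                  []          = []
    unique-sources {_ ∷ _} {p′ ∷ _} ((i , _ , ext) ∷ pw) (d ∷ ds) =
      head-fresh pw d ∷ unique-sources pw ds
      where
      head-fresh : ∀ {qs qs′} (pw′ : Pointwise Corresponds qs qs′) →
                   All (VertexDisjoint w⁺ p′) qs′ → All (i ≢_) (sources pw′)
      head-fresh []                  []         = []
      head-fresh ((_ , _ , ext′) ∷ pw′) (d′ ∷ ds′) =
        distinct-sources ext ext′ d′ ∷ head-fresh pw′ ds′

    pathsWeight-shift : ∀ {ps ps′} (pw : Pointwise Corresponds ps ps′) →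
                        pathsWeight w⁺ ps′ ≡ sumList x (sources pw) + pathsWeight w ps
    pathsWeight-shift [] = sym (IsCommutativeRing.+-identityʳ isCommutativeRing 0#)
    pathsWeight-shift {p ∷ ps} {p′ ∷ ps′} ((i , _ , ext) ∷ pw) = begin
      pathWeight w⁺ p′ + pathsWeight w⁺ ps′
        ≡⟨ cong₂ _+_ (weight≡ ext) (pathsWeight-shift pw) ⟩
      (x i + pathWeight w p) + (sumList x (sources pw) + pathsWeight w ps)
        ≡⟨ interchange (x i) _ _ _ ⟩
      (x i + sumList x (sources pw)) + (pathWeight w p + pathsWeight w ps) ∎
      where open ≡-Reasoning

    pathsWeight-translate : ∀ {ps ps′} (pw : Pointwise Corresponds ps ps′) →
                            AllPairs (VertexDisjoint w⁺) ps′ → length ps ≡ ∣ I ∣ →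
                            pathsWeight w⁺ ps′ ≡ pathsWeight w ps + sumOver I x
    pathsWeight-translate {ps} {ps′} pw ds |ps|≡|I| = begin
      pathsWeight w⁺ ps′                          ≡⟨ pathsWeight-shift pw ⟩
      sumList x (sources pw) + pathsWeight w ps   ≡⟨ cong (_+ pathsWeight w ps) sources-sum ⟩
      sumOver I x + pathsWeight w ps              ≡⟨ IsCommutativeRing.+-comm isCommutativeRing _ _ ⟩
      pathsWeight w ps + sumOver I x              ∎
      where
      open ≡-Reasoning
      sources-sum : sumList x (sources pw) ≡ sumOver I x
      sources-sum = sumList≡sumOver x I (unique-sources pw ds) (sources⊆I pw)
                      (trans (length-sources pw) |ps|≡|I|)

    module _ {size : ℕ} (∣I∣≡size : ∣ I ∣ ≡ size) where

      extendLinking : (L : Linking w (imageOf ι I) S size) →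
                      Σ (Linking w⁺ (imageOf new I) S⁺ size) λ L′ →
                        linkingWeight w⁺ L′ ≡ linkingWeight w L + sumOver I x
      extendLinking L with All⇒Pointwise extend (ends L)
      ... | ps′ , pw = L′ , pathsWeight-translate pw (disjoint L′) (trans (count L) (sym ∣I∣≡size))
        where
        L′ : Linking w⁺ (imageOf new I) S⁺ size
        L′ = record
          { paths    = ps′
          ; count    = trans (sym (Pointwise-length pw)) (count L)
          ; disjoint = AllPairs-transport (λ (_ , _ , e) (_ , _ , e′) → vertexDisjoint⁺ e e′)
                                          pw (disjoint L)
          ; ends     = All-transport endsIn⁺ pw (ends L) }

      restrictLinking : (L′ : Linking w⁺ (imageOf new I) S⁺ size) →
                        Σ (Linking w (imageOf ι I) S size) λ L →
                          linkingWeight w⁺ L′ ≡ linkingWeight w L + sumOver I x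
      restrictLinking L′ with All⇒Pointwise {R = flip Corresponds} restrict (ends L′)
      ... | ps , pw⁻ = L , pathsWeight-translate pw (disjoint L′) (trans (count L) (sym ∣I∣≡size))
        where
        pw : Pointwise Corresponds ps (paths L′)
        pw = symmetric (λ c → c) pw⁻
        L : Linking w (imageOf ι I) S size
        L = record
          { paths    = ps
          ; count    = trans (Pointwise-length pw) (count L′)
          ; disjoint = AllPairs-transport (λ (_ , _ , e) (_ , _ , e′) → vertexDisjoint⁻ e e′)
                                          pw⁻ (disjoint L′)
          ; ends     = All-transport endsIn⁻ pw⁻ (ends L′) }

      isMinLinkingWeight-translate :
        ∀ μ → IsMinLinkingWeight w (imageOf ι I) S size μ →
        IsMinLinkingWeight w⁺ (imageOf new I) S⁺ size (μ +∞ sumOver I x)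
      isMinLinkingWeight-translate nothing  none L′ = none (proj₁ (restrictLinking L′))
      isMinLinkingWeight-translate (just a) ((L , wL≡a) , a≤) =
        (proj₁ (extendLinking L) , trans (proj₂ (extendLinking L)) (cong (_+ sumOver I x) wL≡a)) ,
        λ L′ → let L , wL′≡ = restrictLinking L′ in
               subst (a + sumOver I x ≤_) (sym wL′≡) (+-mono-≤ (sumOver I x) (a≤ L))

proposition7p3 : (ℝ : RealNumbers) (n s : ℕ) (d : Fin s → ℕ)
    (μ : Gammoid.FlagTuple ℝ n s d) (x : Fin n → RealNumbers.Carrier ℝ) →
    Gammoid.IsValuatedFlagGammoid ℝ n s d μ →
    Gammoid.IsValuatedFlagGammoid ℝ n s d (Gammoid.translate ℝ μ x)
proposition7p3 ℝ n s d μ x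
  (d-mono , m , ι , _ , w , noNeg , S , ∣S∣ , S-mono , S-linked , μ-min) =
  d-mono , m ℕ.+ n , new , ↑ʳ-injective m _ _ , w⁺ , noNegativeCycle⁺ noNeg ,
  (λ k → S k ++ ∅) ,
  (λ k → trans (∣++∅∣ (S k)) (∣S∣ k)) ,
  (λ k l k<l → ++⁺-⊆ ∅ (S-mono k l k<l)) ,
  (λ k → let I , ∣I∣ , L = S-linked k in I , ∣I∣ , proj₁ (extendLinking I (S k) ∣I∣ L)) ,
  (λ k I ∣I∣ → isMinLinkingWeight-translate I (S k) ∣I∣ (μ k I ∣I∣) (μ-min k I ∣I∣))
  where open Extension ℝ ι w x
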